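{- Let $h(x)=\sum_{i\ge1}h_ix^i\in\mathbb{K}[[x]]$ with $h_i\ne0$ for all $i\ge1$. (i) For any $p_0,p_1,\dots,p_n\in\mathbb{K}[[x]]$ and $y_0\in\mathbb{K}$, the initial value problem $\mathcal{D}_h(y)=p_0+p_1y+p_2y^2+\cdots+p_ny^n$, $y(0)=y_0$, has a unique solution in $\mathbb{K}[[x]]$ (powers of $y$ are Cauchy-product powers). (ii) For any positive integer $n$, $q,p_0,p_1,\dots,p_{n-1}\in\mathbb{K}[[x]]$ and $y_0,\dots,y_{n-1}\in\mathbb{K}$, the initial value problem $$\mathcal{D}_h^{(n)}(y)=q+p_0y+p_1\mathcal{D}_h(y)+\cdots+p_{n-1}\mathcal{D}_h^{(n-1)}(y),\quad y(0)=y_0,\ \mathcal{D}_h(y)(0)=y_1,\ \dots,\ \mathcal{D}_h^{(n-1)}(y)(0)=y_{n-1}$$ has a unique solution in $\mathbb{K}[[x]]$.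
   Context: $\mathbb{K}$ is a field of characteristic zero. The $h$-derivative is $\mathcal{D}_h\big(\sum_{k\ge0}s_kx^k\big)=\sum_{k\ge1}h_ks_kx^{k-1}$, and $\mathcal{D}_h^{(n)}$ is its $n$-fold composition. $g(0)$ denotes the constant term of a series $g$. -}

module Defs where

open import Level using (Level; _⊔_)
open import Algebra.Bundles using (CommutativeRing)
open import Data.Nat using (ℕ; zero; suc; _∸_)
open import Data.Fin using (Fin; toℕ)
import Data.Fin as Fin
open import Data.Product using (Σ; ∃; _×_; _,_)
open import Relation.Nullary using (¬_)

module FormalPowerSeries {c ℓ : Level} (R : CommutativeRing c ℓ) where
  open CommutativeRing R

  -- A formal power series s = Σ_k s k · x^k is its coefficient sequence.
  PS : Set c
  PS = ℕ → Carrier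

  _≋_ : PS → PS → Set ℓ
  s ≋ t = ∀ k → s k ≈ t k

  sumFin : (n : ℕ) → (Fin n → Carrier) → Carrier
  sumFin zero    f = 0#
  sumFin (suc n) f = f Fin.zero + sumFin n (λ i → f (Fin.suc i))

  sumUpTo : ℕ → (ℕ → Carrier) → Carrier
  sumUpTo k f = sumFin (suc k) (λ i → f (toℕ i))

  const0 : PS → Carrier
  const0 s = s 0

  _⊕_ : PS → PS → PS
  (s ⊕ t) k = s k + t k

  _⊛_ : PS → PS → PS
  (s ⊛ t) k = sumUpTo k (λ i → s i * t (k ∸ i))

  oneS : PS
  oneS zero    = 1#
  oneS (suc k) = 0#

  powS : PS → ℕ → PS
  powS y zero    = oneS
  powS y (suc m) = y ⊛ powS y m

  sumS : (n : ℕ) → (Fin n → PS) → PS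
  sumS n f k = sumFin n (λ j → f j k)

  -- h-derivative: D_h (Σ s_k x^k) = Σ_{k≥1} h_k s_k x^(k-1)
  Dh : PS → PS → PS
  Dh h s k = h (suc k) * s (suc k)

  DhIter : PS → ℕ → PS → PS
  DhIter h zero    s = s
  DhIter h (suc n) s = Dh h (DhIter h n s)

  SolI : PS → (n : ℕ) → (Fin (suc n) → PS) → Carrier → PS → Set ℓ
  SolI h n p y0 y =
    (Dh h y ≋ sumS (suc n) (λ j → p j ⊛ powS y (toℕ j))) × (const0 y ≈ y0)

  SolII : PS → (n : ℕ) → PS → (Fin n → PS) → (Fin n → Carrier) → PS → Set ℓ
  SolII h n q p ys y =
    (DhIter h n y ≋ (q ⊕ sumS n (λ j → p j ⊛ DhIter h (toℕ j) y)))
    × (∀ (j : Fin n) → const0 (DhIter h (toℕ j) y) ≈ ys j)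

  ∃! : ∀ {a} → (PS → Set a) → Set (c ⊔ ℓ ⊔ a)
  ∃! P = Σ PS (λ y → P y × (∀ z → P z → y ≋ z))

IsField : ∀ {c ℓ} → CommutativeRing c ℓ → Set (c ⊔ ℓ)
IsField R = (¬ (1# ≈ 0#)) × (∀ x → ¬ (x ≈ 0#) → ∃ (λ y → x * y ≈ 1#))
  where open CommutativeRing R

natCast : ∀ {c ℓ} (R : CommutativeRing c ℓ) → ℕ → CommutativeRing.Carrier R
natCast R zero    = CommutativeRing.0# R
natCast R (suc n) = CommutativeRing._+_ R (CommutativeRing.1# R) (natCast R n)

CharZero : ∀ {c ℓ} → CommutativeRing c ℓ → Set ℓ
CharZero R = ∀ n → ¬ (CommutativeRing._≈_ R (natCast R (suc n)) (CommutativeRing.0# R))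

{-# OPTIONS --safe #-}
module Submission where

-- Read coefficientwise, each problem is a triangular system  a_m · y_m = G(y)_m  in which a_m is a
-- product of the h_i, hence a unit, and G(y)_m depends only on y_0, …, y_{m-1}.  Indeed the
-- coefficient of x^k in D_h^(j)(y) is h_{k+1} ⋯ h_{k+j} · y_{k+j}, so coefficient k of D_h^(n)(y)
-- pins down y_{k+n}, while coefficient k of a Cauchy product involves its factors only up to k, so
-- coefficient k of the right-hand side sees y only below k+n.  Such a system has exactly one
-- solution, computed coefficient by coefficient.

open import Defs
open import Algebra.Bundles using (CommutativeRing)
open import Data.Nat using (ℕ; suc; _≤_)
open import Data.Fin using (Fin)
open import Data.Product using (_×_)
open import Relation.Nullary using (¬_)

open import Level using (Level; _⊔_)
import Data.Nat as ℕ
import Data.Nat.Properties as ℕₚ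
open import Data.Nat using (zero; _<_; _<?_; _∸_; s≤s)
open import Data.Nat.Properties
  using (≤-refl; m≤n⇒m<n∨m≡n; <-≤-trans; ≤-<-trans; m∸n≤m; +-monoˡ-<; +-monoʳ-<; +-suc;
         +-cancelʳ-≡; m≤n+m; <⇒≢; ≮⇒≥; m∸n+n≡m; ≡-irrelevant)
open import Data.Fin using (toℕ; fromℕ<)
import Data.Fin as Fin
open import Data.Fin.Properties using (toℕ<n; toℕ-fromℕ<; toℕ-injective)
open import Data.Product using (_,_; proj₁)
open import Data.Sum using (inj₁; inj₂)
open import Relation.Nullary using (yes; no; contradiction)
import Relation.Binary.PropositionalEquality as ≡
open ≡ using (_≡_)

-- Coefficient m of y is fixed either by an initial condition (m < n) or by coefficient m ∸ n of the equation.
data Position (n m : ℕ) : Set where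
  initial   : (j : Fin n) → toℕ j ≡ m → Position n m
  recurrent : (k : ℕ) → k ℕ.+ n ≡ m → Position n m

position : ∀ n m → Position n m
position n m with m <? n
... | yes m<n = initial (fromℕ< m<n) (toℕ-fromℕ< m<n)
... | no  m≮n = recurrent (m ∸ n) (m∸n+n≡m (≮⇒≥ m≮n))

position-irrelevant : ∀ {n m} (σ τ : Position n m) → σ ≡ τ
position-irrelevant (initial j ≡.refl) (initial j′ e) with toℕ-injective e
... | ≡.refl = ≡.cong (initial j) (≡-irrelevant ≡.refl e)
position-irrelevant {n} (recurrent k ≡.refl) (recurrent k′ e) with +-cancelʳ-≡ n k′ k e
... | ≡.refl = ≡.cong (recurrent k) (≡-irrelevant ≡.refl e)
position-irrelevant {n} (initial j ≡.refl) (recurrent k e) =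
  contradiction (≡.sym e) (<⇒≢ (<-≤-trans (toℕ<n j) (m≤n+m n k)))
position-irrelevant {n} (recurrent k ≡.refl) (initial j e) =
  contradiction e (<⇒≢ (<-≤-trans (toℕ<n j) (m≤n+m n k)))

module _ {c ℓ : Level} (R : CommutativeRing c ℓ) where
  open CommutativeRing R hiding (zero)
  open FormalPowerSeries R
  open import Algebra.Definitions _≈_ using (LeftInvertible)
  open import Algebra.Properties.Monoid *-monoid using (cancelˡ)
  open import Algebra.Properties.CommutativeSemigroup *-commutativeSemigroup using (interchange)
  open import Algebra.Properties.CommutativeMonoid *-commutativeMonoid using (invertibleʳ⇒invertibleˡ)
  open import Relation.Binary.Reasoning.Setoid setoid

  Unit : Carrier → Set (c ⊔ ℓ)
  Unit = LeftInvertible 1# _*_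

  1-unit : Unit 1#
  1-unit = 1# , *-identityˡ 1#

  *-unit : ∀ {a b} → Unit a → Unit b → Unit (a * b)
  *-unit (a⁻¹ , a⁻¹a≈1) (b⁻¹ , b⁻¹b≈1) =
    a⁻¹ * b⁻¹ , trans (interchange a⁻¹ b⁻¹ _ _) (trans (*-cong a⁻¹a≈1 b⁻¹b≈1) (*-identityˡ 1#))

  nonzero⇒unit : IsField R → ∀ {x} → ¬ (x ≈ 0#) → Unit x
  nonzero⇒unit (_ , inverse) x≉0 = invertibleʳ⇒invertibleˡ (inverse _ x≉0)

  unit-cancelˡ : ∀ {a u v} → Unit a → a * u ≈ a * v → u ≈ v
  unit-cancelˡ {a} {u} {v} (a⁻¹ , a⁻¹a≈1) au≈av = begin
    u               ≈⟨ cancelˡ a⁻¹a≈1 u ⟨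
    a⁻¹ * (a * u)   ≈⟨ *-congˡ au≈av ⟩
    a⁻¹ * (a * v)   ≈⟨ cancelˡ a⁻¹a≈1 v ⟩
    v               ∎

  unit-inverse-cancelˡ : ∀ {a} (u : Unit a) b → a * (proj₁ u * b) ≈ b
  unit-inverse-cancelˡ {a} (a⁻¹ , a⁻¹a≈1) = cancelˡ (trans (*-comm a a⁻¹) a⁻¹a≈1)

  sumFin-cong : ∀ n {f g : Fin n → Carrier} → (∀ i → f i ≈ g i) → sumFin n f ≈ sumFin n g
  sumFin-cong zero    f≈g = refl
  sumFin-cong (suc n) f≈g = +-cong (f≈g Fin.zero) (sumFin-cong n (λ i → f≈g (Fin.suc i)))

  AgreeBelow : ℕ → PS → PS → Set ℓ
  AgreeBelow m s t = ∀ i → i < m → s i ≈ t i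

  AgreeBelow-refl : ∀ {m} s → AgreeBelow m s s
  AgreeBelow-refl s _ _ = refl

  AgreeBelow-mono : ∀ {m m′ s t} → m ≤ m′ → AgreeBelow m′ s t → AgreeBelow m s t
  AgreeBelow-mono m≤m′ s≈t i i<m = s≈t i (<-≤-trans i<m m≤m′)

  AgreeBelow-suc : ∀ {m s t} → AgreeBelow m s t → s m ≈ t m → AgreeBelow (suc m) s t
  AgreeBelow-suc s≈t sₘ≈tₘ i (s≤s i≤m) with m≤n⇒m<n∨m≡n i≤m
  ... | inj₁ i<m    = s≈t i i<m
  ... | inj₂ ≡.refl = sₘ≈tₘ

  ⊕-agreeBelow : ∀ {m s s′ t t′} → AgreeBelow m s s′ → AgreeBelow m t t′ →
                 AgreeBelow m (s ⊕ t) (s′ ⊕ t′)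
  ⊕-agreeBelow s≈s′ t≈t′ i i<m = +-cong (s≈s′ i i<m) (t≈t′ i i<m)

  ⊛-agreeBelow : ∀ {m s s′ t t′} → AgreeBelow m s s′ → AgreeBelow m t t′ →
                 AgreeBelow m (s ⊛ t) (s′ ⊛ t′)
  ⊛-agreeBelow s≈s′ t≈t′ i i<m = sumFin-cong (suc i) λ j → *-cong
    (s≈s′ (toℕ j) (<-≤-trans (toℕ<n j) i<m))
    (t≈t′ (i ∸ toℕ j) (≤-<-trans (m∸n≤m i (toℕ j)) i<m))

  powS-agreeBelow : ∀ {m s t} k → AgreeBelow m s t → AgreeBelow m (powS s k) (powS t k)
  powS-agreeBelow zero    s≈t _ _ = refl
  powS-agreeBelow (suc k) s≈t     = ⊛-agreeBelow s≈t (powS-agreeBelow k s≈t)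

  sumS-agreeBelow : ∀ {m} n {f g : Fin n → PS} → (∀ j → AgreeBelow m (f j) (g j)) →
                    AgreeBelow m (sumS n f) (sumS n g)
  sumS-agreeBelow n f≈g i i<m = sumFin-cong n (λ j → f≈g j i i<m)

  Causal : (PS → ℕ → Carrier) → Set (c ⊔ ℓ)
  Causal G = ∀ s t m → AgreeBelow m s t → G s m ≈ G t m

  ∃!-resp : ∀ {a b} {P : PS → Set a} {Q : PS → Set b} →
            (∀ y → P y → Q y) → (∀ y → Q y → P y) → ∃! P → ∃! Q
  ∃!-resp P⇒Q Q⇒P (y , Py , unique) = y , P⇒Q y Py , λ z Qz → unique z (Q⇒P z Qz)

  module TriangularSystem (a : ℕ → Carrier) (a-unit : ∀ m → Unit (a m))
                          (G : PS → ℕ → Carrier) (G-causal : Causal G) where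

    Solves : PS → Set ℓ
    Solves y = ∀ m → a m * y m ≈ G y m

    solves-agreeBelow : ∀ {y z} → Solves y → Solves z → ∀ m → AgreeBelow m y z
    solves-agreeBelow sy sz zero    i ()
    solves-agreeBelow {y} {z} sy sz (suc m) = AgreeBelow-suc y≈z (unit-cancelˡ (a-unit m) (begin
      a m * y m  ≈⟨ sy m ⟩
      G y m      ≈⟨ G-causal y z m y≈z ⟩
      G z m      ≈⟨ sz m ⟨
      a m * z m  ∎))
      where y≈z = solves-agreeBelow sy sz m

    solves-unique : ∀ {y z} → Solves y → Solves z → y ≋ z
    solves-unique sy sz m = solves-agreeBelow sy sz (suc m) m ≤-refl

    solution : PS

    approx : ℕ → PS
    approx zero    i = 0#
    approx (suc k) i with i <? k
    ... | yes _ = approx k i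
    ... | no  _ = solution k

    solution m = proj₁ (a-unit m) * G (approx m) m

    approx≡solution : ∀ k i → i < k → approx k i ≡ solution i
    approx≡solution (suc k) i (s≤s i≤k) with i <? k
    ... | yes i<k = approx≡solution k i i<k
    ... | no  i≮k with m≤n⇒m<n∨m≡n i≤k
    ...   | inj₁ i<k    = contradiction i<k i≮k
    ...   | inj₂ ≡.refl = ≡.refl

    solution-solves : Solves solution
    solution-solves m = begin
      a m * solution m  ≈⟨ unit-inverse-cancelˡ (a-unit m) _ ⟩
      G (approx m) m    ≈⟨ G-causal _ _ m (λ i i<m → reflexive (approx≡solution m i i<m)) ⟩
      G solution m      ∎

    ∃!-Solves : ∃! Solves
    ∃!-Solves = solution , solution-solves , λ z sz → solves-unique solution-solves sz

  module _ (h : PS) where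

    hProduct : ℕ → ℕ → Carrier
    hProduct k zero    = 1#
    hProduct k (suc j) = h (suc k) * hProduct (suc k) j

    hProduct-unit : (∀ i → Unit (h (suc i))) → ∀ k j → Unit (hProduct k j)
    hProduct-unit h-unit k zero    = 1-unit
    hProduct-unit h-unit k (suc j) = *-unit (h-unit k) (hProduct-unit h-unit (suc k) j)

    DhIter-coefficient : ∀ j y k → DhIter h j y k ≈ hProduct k j * y (k ℕ.+ j)
    DhIter-coefficient zero    y k = begin
      y k                   ≈⟨ *-identityˡ (y k) ⟨
      1# * y k              ≡⟨ ≡.cong (λ i → 1# * y i) (ℕₚ.+-identityʳ k) ⟨
      1# * y (k ℕ.+ zero)   ∎
    DhIter-coefficient (suc j) y k = begin
      h (suc k) * DhIter h j y (suc k)                      ≈⟨ *-congˡ (DhIter-coefficient j y (suc k)) ⟩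
      h (suc k) * (hProduct (suc k) j * y (suc k ℕ.+ j))    ≈⟨ *-assoc _ _ _ ⟨
      hProduct k (suc j) * y (suc (k ℕ.+ j))                ≡⟨ ≡.cong (λ i → hProduct k (suc j) * y i) (+-suc k j) ⟨
      hProduct k (suc j) * y (k ℕ.+ suc j)                  ∎

    DhIter-agreeBelow : ∀ {m s t} j → AgreeBelow (m ℕ.+ j) s t →
                        AgreeBelow m (DhIter h j s) (DhIter h j t)
    DhIter-agreeBelow {s = s} {t} j s≈t i i<m = begin
      DhIter h j s i             ≈⟨ DhIter-coefficient j s i ⟩
      hProduct i j * s (i ℕ.+ j)  ≈⟨ *-congˡ (s≈t (i ℕ.+ j) (+-monoˡ-< j i<m)) ⟩
      hProduct i j * t (i ℕ.+ j)  ≈⟨ DhIter-coefficient j t i ⟨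
      DhIter h j t i             ∎

    module PolynomialIVP (h-unit : ∀ i → Unit (h (suc i)))
                         (n : ℕ) (p : Fin (suc n) → PS) (y0 : Carrier) where

      polynomial : PS → PS
      polynomial y = sumS (suc n) (λ j → p j ⊛ powS y (toℕ j))

      pivot : ℕ → Carrier
      pivot zero    = 1#
      pivot (suc k) = h (suc k)

      pivot-unit : ∀ m → Unit (pivot m)
      pivot-unit zero    = 1-unit
      pivot-unit (suc k) = h-unit k

      rhs : PS → ℕ → Carrier
      rhs y zero    = y0
      rhs y (suc k) = polynomial y k

      rhs-causal : Causal rhs
      rhs-causal s t zero    _   = refl
      rhs-causal s t (suc k) s≈t = sumS-agreeBelow (suc n)
        (λ j → ⊛-agreeBelow (AgreeBelow-refl (p j)) (powS-agreeBelow (toℕ j) s≈t)) k ≤-refl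

      open TriangularSystem pivot pivot-unit rhs rhs-causal

      solves⇒SolI : ∀ y → Solves y → SolI h n p y0 y
      solves⇒SolI y sy = (λ k → sy (suc k)) , trans (sym (*-identityˡ (y 0))) (sy 0)

      SolI⇒solves : ∀ y → SolI h n p y0 y → Solves y
      SolI⇒solves y (_   , y₀≈y0) zero    = trans (*-identityˡ (y 0)) y₀≈y0
      SolI⇒solves y (ode , _    ) (suc k) = ode k

      ∃!-SolI : ∃! (SolI h n p y0)
      ∃!-SolI = ∃!-resp solves⇒SolI SolI⇒solves ∃!-Solves

    module LinearIVP (h-unit : ∀ i → Unit (h (suc i)))
                     (n : ℕ) (q : PS) (p : Fin n → PS) (ys : Fin n → Carrier) where

      linear : PS → PS
      linear y = q ⊕ sumS n (λ j → p j ⊛ DhIter h (toℕ j) y)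

      linear-agreeBelow : ∀ {k s t} → AgreeBelow (k ℕ.+ n) s t →
                          AgreeBelow (suc k) (linear s) (linear t)
      linear-agreeBelow {k} s≈t = ⊕-agreeBelow (AgreeBelow-refl q) (sumS-agreeBelow n λ j →
        ⊛-agreeBelow (AgreeBelow-refl (p j))
          (DhIter-agreeBelow (toℕ j) (AgreeBelow-mono (+-monoʳ-< k (toℕ<n j)) s≈t)))

      pivotAt : ∀ {m} → Position n m → Carrier
      pivotAt (initial j _)   = hProduct 0 (toℕ j)
      pivotAt (recurrent k _) = hProduct k n

      rhsAt : PS → ∀ {m} → Position n m → Carrier
      rhsAt y (initial j _)   = ys j
      rhsAt y (recurrent k _) = linear y k

      EquationAt : PS → ∀ {m} → Position n m → Set ℓ
      EquationAt y {m} σ = pivotAt σ * y m ≈ rhsAt y σ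

      pivotAt-unit : ∀ {m} (σ : Position n m) → Unit (pivotAt σ)
      pivotAt-unit (initial j _)   = hProduct-unit h-unit 0 (toℕ j)
      pivotAt-unit (recurrent k _) = hProduct-unit h-unit k n

      rhsAt-causal : ∀ {s t m} (σ : Position n m) → AgreeBelow m s t → rhsAt s σ ≈ rhsAt t σ
      rhsAt-causal (initial j _)        _   = refl
      rhsAt-causal (recurrent k ≡.refl) s≈t = linear-agreeBelow s≈t k ≤-refl

      open TriangularSystem (λ m → pivotAt (position n m)) (λ m → pivotAt-unit (position n m))
                            (λ y m → rhsAt y (position n m)) (λ s t m → rhsAt-causal (position n m))

      solves-at : ∀ {y} → Solves y → ∀ {m} (σ : Position n m) → EquationAt y σ
      solves-at {y} sy {m} σ = ≡.subst (EquationAt y) (position-irrelevant (position n m) σ) (sy m)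

      solves⇒SolII : ∀ y → Solves y → SolII h n q p ys y
      solves⇒SolII y sy =
        (λ k → trans (DhIter-coefficient n y k) (solves-at sy (recurrent k ≡.refl))) ,
        (λ j → trans (DhIter-coefficient (toℕ j) y 0) (solves-at sy (initial j ≡.refl)))

      SolII⇒EquationAt : ∀ y → SolII h n q p ys y → ∀ {m} (σ : Position n m) → EquationAt y σ
      SolII⇒EquationAt y (_ , initials) (initial j ≡.refl) =
        trans (sym (DhIter-coefficient (toℕ j) y 0)) (initials j)
      SolII⇒EquationAt y (ode , _) (recurrent k ≡.refl) =
        trans (sym (DhIter-coefficient n y k)) (ode k)

      ∃!-SolII : ∃! (SolII h n q p ys)
      ∃!-SolII = ∃!-resp solves⇒SolII (λ y sol m → SolII⇒EquationAt y sol (position n m)) ∃!-Solves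

mainTheorem4 : ∀ {c ℓ} (K : CommutativeRing c ℓ) → IsField K → CharZero K →
    let open CommutativeRing K
        open FormalPowerSeries K
    in (h : PS) → h 0 ≈ 0# → (∀ i → ¬ (h (suc i) ≈ 0#)) →
       ((n : ℕ) (p : Fin (suc n) → PS) (y0 : Carrier) →
          ∃! (λ y → SolI h n p y0 y))
       ×
       ((n : ℕ) → 1 ≤ n → (q : PS) (p : Fin n → PS) (ys : Fin n → Carrier) →
          ∃! (λ y → SolII h n q p ys y))
mainTheorem4 K isField _ h _ h≉0 =
  (λ n p y0 → PolynomialIVP.∃!-SolI K h h-unit n p y0) ,
  (λ n _ q p ys → LinearIVP.∃!-SolII K h h-unit n q p ys)
  where
    h-unit : ∀ i → Unit K (h (suc i))
    h-unit i = nonzero⇒unit K isField (h≉0 i)
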